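{- For any formulas $\alpha,\beta$ over a finite signature $\Sigma$, $\alpha$ strongly entails $\beta$ if and only if both of the following hold: (i) $[\![\alpha]\!]_c\subseteq[\![\beta]\!]_c$; (ii) $[\![\alpha]\!]_c\downarrow\cap[\![\beta]\!]\subseteq[\![\alpha]\!]$.
   Context: $\Sigma$ is a finite set of atoms. Formulas are given by $\alpha ::= \bot \mid p \mid \alpha_1\wedge\alpha_2 \mid \alpha_1\vee\alpha_2 \mid \alpha_1\rightarrow\alpha_2$ with $p\in\Sigma$. A partial interpretation is a map $v:\Sigma\to\{0,1,2\}$; $\mathcal I$ is the set of all of them and $\mathcal I_c$ the set of classical ones (no atom mapped to $1$). The $G_3$ valuation extends $v$ to formulas: $v(\bot)=0$, $v(\alpha\wedge\beta)=\min(v(\alpha),v(\beta))$, $v(\alpha\vee\beta)=\max(v(\alpha),v(\beta))$, $v(\alpha\to\beta)=2$ if $v(\alpha)\le v(\beta)$ and $=v(\beta)$ otherwise; $v$ is a model of $\alpha$ iff $v(\alpha)=2$. The order on $\mathcal I$: $u\le v$ iff for every atom $p$, $u(p)\le v(p)$ and ($u(p)=0$ implies $v(p)=0$). A classical interpretation $v\in\mathcal I_c$ is an equilibrium model of $\alpha$ iff it is a $\le$-minimal model of $\alpha$; $[\![\alpha]\!]_e$ denotes the set of equilibrium models of $\alpha$. For $S\subseteq\mathcal I$: $\overline S=\mathcal I\setminus S$; $S_c=S\cap\mathcal I_c$; $S\downarrow=\{u\in\mathcal I:\exists v\in S,\ v\ge u\}$ (so $S_c\downarrow=(S_c)\downarrow$).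 The denotation: $[\![\bot]\!]=\emptyset$; $[\![p]\!]=\{v\in\mathcal I: v(p)=2\}$; $[\![\alpha\wedge\beta]\!]=[\![\alpha]\!]\cap[\![\beta]\!]$; $[\![\alpha\vee\beta]\!]=[\![\alpha]\!]\cup[\![\beta]\!]$; $[\![\alpha\to\beta]\!]=\big(\overline{[\![\alpha]\!]}\cup[\![\beta]\!]\big)\cap\big(\overline{[\![\alpha]\!]}\cup[\![\beta]\!]\big)_c\downarrow$. We say $\alpha$ strongly entails $\beta$ iff for every formula $\gamma$ over $\Sigma$, $[\![\alpha\wedge\gamma]\!]_e\subseteq[\![\beta\wedge\gamma]\!]_e$. -}

module Defs where

open import Data.Nat using (ℕ)
open import Data.Fin using (Fin)
open import Data.Product using (_×_; Σ; ∃)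
open import Data.Sum using (_⊎_)
open import Data.Empty using (⊥)
open import Data.Unit using (⊤)
open import Relation.Nullary using (¬_)
open import Relation.Binary.PropositionalEquality using (_≡_)

-- Truth values {0,1,2} of the logic G3 / here-and-there
data V : Set where
  v0 v1 v2 : V

data _≤V_ : V → V → Set where
  0≤ : ∀ {x} → v0 ≤V x
  1≤1 : v1 ≤V v1
  1≤2 : v1 ≤V v2
  2≤2 : v2 ≤V v2

minV : V → V → V
minV v0 _ = v0
minV v1 v0 = v0
minV v1 _ = v1
minV v2 y = y

maxV : V → V → V
maxV v0 y = y
maxV v1 v2 = v2
maxV v1 _ = v1
maxV v2 _ = v2

impV : V → V → V
impV v0 _ = v2
impV v1 v0 = v0
impV v1 _ = v2
impV v2 y = y

data Form (n : ℕ) : Set where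
  ⊥f  : Form n
  atom : Fin n → Form n
  _∧f_ _∨f_ _⇒f_ : Form n → Form n → Form n

Interp : ℕ → Set
Interp n = Fin n → V

val : ∀ {n} → Interp n → Form n → V
val v ⊥f = v0
val v (atom p) = v p
val v (a ∧f b) = minV (val v a) (val v b)
val v (a ∨f b) = maxV (val v a) (val v b)
val v (a ⇒f b) = impV (val v a) (val v b)

Model : ∀ {n} → Interp n → Form n → Set
Model v α = val v α ≡ v2

Classical : ∀ {n} → Interp n → Set
Classical v = ∀ p → ¬ (v p ≡ v1)

_≤I_ : ∀ {n} → Interp n → Interp n → Set
u ≤I v = ∀ p → (u p ≤V v p) × (u p ≡ v0 → v p ≡ v0)

_≗I_ : ∀ {n} → Interp n → Interp n → Set
u ≗I v = ∀ p → u p ≡ v p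

Equilibrium : ∀ {n} → Form n → Interp n → Set
Equilibrium α v = Classical v × Model v α × (∀ u → u ≤I v → Model u α → u ≗I v)

ISet : ℕ → Set₁
ISet n = Interp n → Set

_⊆_ : ∀ {n} → ISet n → ISet n → Set
S ⊆ T = ∀ v → S v → T v

∅ : ∀ {n} → ISet n
∅ _ = ⊥

compl : ∀ {n} → ISet n → ISet n
compl S v = ¬ S v

_∩_ _∪_ : ∀ {n} → ISet n → ISet n → ISet n
(S ∩ T) v = S v × T v
(S ∪ T) v = S v ⊎ T v

cl : ∀ {n} → ISet n → ISet n
cl S v = S v × Classical v

down : ∀ {n} → ISet n → ISet n
down S u = Σ _ λ v → S v × (u ≤I v)

⟦_⟧ : ∀ {n} → Form n → ISet n
⟦ ⊥f ⟧ = ∅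
⟦ atom p ⟧ v = v p ≡ v2
⟦ a ∧f b ⟧ = ⟦ a ⟧ ∩ ⟦ b ⟧
⟦ a ∨f b ⟧ = ⟦ a ⟧ ∪ ⟦ b ⟧
⟦ a ⇒f b ⟧ = (compl ⟦ a ⟧ ∪ ⟦ b ⟧) ∩ down (cl (compl ⟦ a ⟧ ∪ ⟦ b ⟧))

⟦_⟧e : ∀ {n} → Form n → ISet n
⟦ α ⟧e = Equilibrium α

StronglyEntails : ∀ {n} → Form n → Form n → Set
StronglyEntails {n} α β = (γ : Form n) → ⟦ α ∧f γ ⟧e ⊆ ⟦ β ∧f γ ⟧e

-- The denotation ⟦ α ⟧ is exactly the set of G3-models of α, so the two
-- conditions are sufficient by unfolding the definition of equilibrium model.
-- For necessity, every interpretation u has a characteristic formula char u,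
-- true at u and at every classical w ≥ u, whose models below such a w are
-- only w and (possibly) u. If u ⊭ α but some classical w ≥ u satisfies α,
-- then w is an equilibrium model of α ∧ char u; strong entailment makes it one
-- of β ∧ char u, which forces u ⊭ β. Taking u = w gives condition (i).
module Submission where

open import Defs
open import Data.Nat using (ℕ; zero; suc)
open import Data.Fin using (Fin; zero; suc)
open import Data.Product using (_×_; _,_; proj₁; proj₂)
open import Data.Sum using (_⊎_; inj₁; inj₂; [_,_])
import Data.Sum as Sum
open import Data.Empty using (⊥-elim)
open import Function using (_∘_; id)
open import Function.Bundles using (_⇔_; mk⇔; Equivalence)
open import Relation.Nullary using (¬_; Dec; yes; no)
open import Relation.Nullary.Decidable using (decidable-stable)
open import Relation.Binary.PropositionalEquality
  using (_≡_; _≢_; refl; sym; trans; cong; cong₂; subst)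

open Equivalence using (to; from)

private
  variable
    n : ℕ
    x y : V
    u u′ v w : Interp n
    α β a b : Form n

-- The "there" world of the here-and-there reading of a G3 value.
there : V → V
there v0 = v0
there v1 = v2
there v2 = v2

there-minV : ∀ x y → minV (there x) (there y) ≡ there (minV x y)
there-minV v0 y  = refl
there-minV v1 v0 = refl
there-minV v1 v1 = refl
there-minV v1 v2 = refl
there-minV v2 v0 = refl
there-minV v2 v1 = refl
there-minV v2 v2 = refl

there-maxV : ∀ x y → maxV (there x) (there y) ≡ there (maxV x y)
there-maxV v0 y  = refl
there-maxV v1 v0 = refl
there-maxV v1 v1 = refl
there-maxV v1 v2 = refl
there-maxV v2 v0 = refl
there-maxV v2 v1 = refl
there-maxV v2 v2 = refl

there-impV : ∀ x y → impV (there x) (there y) ≡ there (impV x y)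
there-impV v0 y  = refl
there-impV v1 v0 = refl
there-impV v1 v1 = refl
there-impV v1 v2 = refl
there-impV v2 v0 = refl
there-impV v2 v1 = refl
there-impV v2 v2 = refl

there≢v1 : ∀ x → there x ≢ v1
there≢v1 v0 ()
there≢v1 v1 ()
there≢v1 v2 ()

≤V-refl : ∀ x → x ≤V x
≤V-refl v0 = 0≤
≤V-refl v1 = 1≤1
≤V-refl v2 = 2≤2

≤V-there : ∀ x → (x ≤V there x) × (x ≡ v0 → there x ≡ v0)
≤V-there v0 = 0≤ , λ _ → refl
≤V-there v1 = 1≤2 , λ ()
≤V-there v2 = 2≤2 , λ ()

≤V-classical⇒there : x ≤V y → (x ≡ v0 → y ≡ v0) → y ≢ v1 → y ≡ there x
≤V-classical⇒there {v0} 0≤ zero-kept _ = zero-kept refl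
≤V-classical⇒there 1≤1 _ y≢v1 = ⊥-elim (y≢v1 refl)
≤V-classical⇒there 1≤2 _ _ = refl
≤V-classical⇒there 2≤2 _ _ = refl

minV-v2 : ∀ x y → minV x y ≡ v2 ⇔ (x ≡ v2 × y ≡ v2)
minV-v2 x y = mk⇔ (split x y) (λ { (refl , refl) → refl })
  where
  split : ∀ x y → minV x y ≡ v2 → x ≡ v2 × y ≡ v2
  split v0 y  ()
  split v1 v0 ()
  split v1 v1 ()
  split v1 v2 ()
  split v2 y  e = refl , e

maxV-v2 : ∀ x y → maxV x y ≡ v2 ⇔ (x ≡ v2 ⊎ y ≡ v2)
maxV-v2 x y = mk⇔ (split x y) (join x y)
  where
  split : ∀ x y → maxV x y ≡ v2 → x ≡ v2 ⊎ y ≡ v2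
  split v0 y  e  = inj₂ e
  split v1 v0 ()
  split v1 v1 ()
  split v1 v2 _  = inj₂ refl
  split v2 y  _  = inj₁ refl
  join : ∀ x y → x ≡ v2 ⊎ y ≡ v2 → maxV x y ≡ v2
  join v0 y  (inj₂ e)  = e
  join v1 v2 (inj₂ _)  = refl
  join v2 y  _         = refl

impV-v2 : ∀ x y → (x ≡ v2 → y ≡ v2) → (there x ≡ v2 → there y ≡ v2) → impV x y ≡ v2
impV-v2 v0 y  _ _ = refl
impV-v2 v1 v0 _ k = k refl
impV-v2 v1 v1 _ _ = refl
impV-v2 v1 v2 _ _ = refl
impV-v2 v2 y  h _ = h refl

impV-v2⁻ : ∀ x y → impV x y ≡ v2 → x ≢ v2 ⊎ y ≡ v2
impV-v2⁻ v0 y _ = inj₁ λ ()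
impV-v2⁻ v1 y _ = inj₁ λ ()
impV-v2⁻ v2 y e = inj₂ e

impV-≡ : x ≡ y → impV x y ≡ v2
impV-≡ {v0} refl = refl
impV-≡ {v1} refl = refl
impV-≡ {v2} refl = refl

≤I-refl : v ≤I v
≤I-refl {v = v} p = ≤V-refl (v p) , id

≤I-there : v ≤I (there ∘ v)
≤I-there {v = v} p = ≤V-there (v p)

there-classical : Classical (there ∘ v)
there-classical {v = v} p = there≢v1 (v p)

≤I-classical⇒there : Classical w → v ≤I w → w ≗I (there ∘ v)
≤I-classical⇒there cw v≤w p = ≤V-classical⇒there (proj₁ (v≤w p)) (proj₂ (v≤w p)) (cw p)

val-cong : u ≗I v → ∀ α → val u α ≡ val v α
val-cong e ⊥f       = refl
val-cong e (atom p) = e p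
val-cong e (a ∧f b) = cong₂ minV (val-cong e a) (val-cong e b)
val-cong e (a ∨f b) = cong₂ maxV (val-cong e a) (val-cong e b)
val-cong e (a ⇒f b) = cong₂ impV (val-cong e a) (val-cong e b)

model-cong : ∀ α → u ≗I v → Model u α → Model v α
model-cong α e m = trans (sym (val-cong e α)) m

val-there : ∀ (v : Interp n) α → val (there ∘ v) α ≡ there (val v α)
val-there v ⊥f       = refl
val-there v (atom p) = refl
val-there v (a ∧f b) = trans (cong₂ minV (val-there v a) (val-there v b)) (there-minV (val v a) (val v b))
val-there v (a ∨f b) = trans (cong₂ maxV (val-there v a) (val-there v b)) (there-maxV (val v a) (val v b))
val-there v (a ⇒f b) = trans (cong₂ impV (val-there v a) (val-there v b)) (there-impV (val v a) (val v b))

val-classical-above : Classical w → v ≤I w → ∀ α → val w α ≡ there (val v α)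
val-classical-above {v = v} cw v≤w α = trans (val-cong (≤I-classical⇒there cw v≤w) α) (val-there v α)

model? : ∀ (v : Interp n) α → Dec (Model v α)
model? v α with val v α
... | v0 = no λ ()
... | v1 = no λ ()
... | v2 = yes refl

model-∧ : ∀ a b → Model v (a ∧f b) ⇔ (Model v a × Model v b)
model-∧ {v = v} a b = minV-v2 (val v a) (val v b)

mutual
  ⟦⟧⇒model : ∀ α (v : Interp n) → ⟦ α ⟧ v → Model v α
  ⟦⟧⇒model ⊥f       v ()
  ⟦⟧⇒model (atom p) v h = h
  ⟦⟧⇒model (a ∧f b) v (ha , hb) = from (model-∧ a b) (⟦⟧⇒model a v ha , ⟦⟧⇒model b v hb)
  ⟦⟧⇒model (a ∨f b) v h =
    from (maxV-v2 (val v a) (val v b)) (Sum.map (⟦⟧⇒model a v) (⟦⟧⇒model b v) h)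
  ⟦⟧⇒model (a ⇒f b) v (hv , w , (hw , cw) , v≤w) =
    impV-v2 (val v a) (val v b) (disjunct⇒implication a b v hv) at-there
    where
    at-there : there (val v a) ≡ v2 → there (val v b) ≡ v2
    at-there ma = trans (sym (val-classical-above cw v≤w b))
      (disjunct⇒implication a b w hw (trans (val-classical-above cw v≤w a) ma))

  model⇒⟦⟧ : ∀ α (v : Interp n) → Model v α → ⟦ α ⟧ v
  model⇒⟦⟧ ⊥f       v ()
  model⇒⟦⟧ (atom p) v m = m
  model⇒⟦⟧ (a ∧f b) v m =
    let ma , mb = to (model-∧ a b) m in model⇒⟦⟧ a v ma , model⇒⟦⟧ b v mb
  model⇒⟦⟧ (a ∨f b) v m =
    Sum.map (model⇒⟦⟧ a v) (model⇒⟦⟧ b v) (to (maxV-v2 (val v a) (val v b)) m)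
  model⇒⟦⟧ (a ⇒f b) v m =
    model⇒disjunct a b v m ,
    there ∘ v , (model⇒disjunct a b (there ∘ v) m-there , there-classical) , ≤I-there
    where
    m-there : Model (there ∘ v) (a ⇒f b)
    m-there = trans (val-there v (a ⇒f b)) (cong there m)

  disjunct⇒implication : ∀ a b (u : Interp n) → (compl ⟦ a ⟧ ∪ ⟦ b ⟧) u → Model u a → Model u b
  disjunct⇒implication a b u (inj₁ ¬ha) ma = ⊥-elim (¬ha (model⇒⟦⟧ a u ma))
  disjunct⇒implication a b u (inj₂ hb)  _  = ⟦⟧⇒model b u hb

  model⇒disjunct : ∀ a b (u : Interp n) → Model u (a ⇒f b) → (compl ⟦ a ⟧ ∪ ⟦ b ⟧) u
  model⇒disjunct a b u m =
    Sum.map (λ ¬ma ha → ¬ma (⟦⟧⇒model a u ha)) (model⇒⟦⟧ b u) (impV-v2⁻ (val u a) (val u b) m)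

⊤f : Form n
⊤f = ⊥f ⇒f ⊥f

⋀ : ∀ {m} → (Fin m → Form n) → Form n
⋀ {m = zero}  f = ⊤f
⋀ {m = suc m} f = f zero ∧f ⋀ (f ∘ suc)

model-⋀ : ∀ {m} (f : Fin m → Form n) → Model v (⋀ f) ⇔ (∀ i → Model v (f i))
model-⋀ {m = zero}  f = mk⇔ (λ _ ()) (λ _ → refl)
model-⋀ {v = v} {m = suc m} f = mk⇔ split join
  where
  head∧tail : Model v (⋀ f) ⇔ (Model v (f zero) × Model v (⋀ (f ∘ suc)))
  head∧tail = model-∧ (f zero) (⋀ (f ∘ suc))
  split : Model v (⋀ f) → ∀ i → Model v (f i)
  split h zero    = proj₁ (to head∧tail h)
  split h (suc i) = to (model-⋀ (f ∘ suc)) (proj₂ (to head∧tail h)) i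
  join : (∀ i → Model v (f i)) → Model v (⋀ f)
  join h = from head∧tail (h zero , from (model-⋀ (f ∘ suc)) (h ∘ suc))

char-atom : V → Fin n → Form n
char-atom v2 p = atom p
char-atom _  p = ⊤f

char-link : V → V → Fin n → Fin n → Form n
char-link v1 v1 p q = atom p ⇒f atom q
char-link _  _  p q = ⊤f

char : Interp n → Form n
char u = ⋀ (λ p → char-atom (u p) p) ∧f ⋀ (λ p → ⋀ (λ q → char-link (u p) (u q) p q))

CharModel : Interp n → Interp n → Set
CharModel u u′ =
  (∀ p → u p ≡ v2 → u′ p ≡ v2) ×
  (∀ p q → u p ≡ v1 → u q ≡ v1 → impV (u′ p) (u′ q) ≡ v2)

model-char-atom : ∀ x p → Model u′ (char-atom x p) ⇔ (x ≡ v2 → u′ p ≡ v2)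
model-char-atom v0 p = mk⇔ (λ _ ()) (λ _ → refl)
model-char-atom v1 p = mk⇔ (λ _ ()) (λ _ → refl)
model-char-atom v2 p = mk⇔ (λ m _ → m) (λ h → h refl)

model-char-link : ∀ x y p q →
  Model u′ (char-link x y p q) ⇔ (x ≡ v1 → y ≡ v1 → impV (u′ p) (u′ q) ≡ v2)
model-char-link v1 v1 p q = mk⇔ (λ m _ _ → m) (λ h → h refl refl)
model-char-link v0 y  p q = mk⇔ (λ _ ()) (λ _ → refl)
model-char-link v2 y  p q = mk⇔ (λ _ ()) (λ _ → refl)
model-char-link v1 v0 p q = mk⇔ (λ _ _ ()) (λ _ → refl)
model-char-link v1 v2 p q = mk⇔ (λ _ _ ()) (λ _ → refl)

model-char : ∀ u → Model u′ (char u) ⇔ CharModel u u′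
model-char {u′ = u′} u = mk⇔ split join
  where
  atoms-f : Fin _ → Form _
  atoms-f p = char-atom (u p) p
  links-f : Fin _ → Fin _ → Form _
  links-f p q = char-link (u p) (u q) p q
  split : Model u′ (char u) → CharModel u u′
  split m =
    let atoms , links = to (model-∧ (⋀ atoms-f) (⋀ (⋀ ∘ links-f))) m in
    (λ p → to (model-char-atom (u p) p) (to (model-⋀ atoms-f) atoms p)) ,
    (λ p q → to (model-char-link (u p) (u q) p q)
               (to (model-⋀ (links-f p)) (to (model-⋀ (⋀ ∘ links-f)) links p) q))
  join : CharModel u u′ → Model u′ (char u)
  join (atoms , links) = from (model-∧ (⋀ atoms-f) (⋀ (⋀ ∘ links-f)))
    ( from (model-⋀ atoms-f) (λ p → from (model-char-atom (u p) p) (atoms p))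
    , from (model-⋀ (⋀ ∘ links-f)) (λ p → from (model-⋀ (links-f p)) (λ q →
        from (model-char-link (u p) (u q) p q) (links p q))))

char-self : CharModel u u
char-self = (λ _ → id) , λ p q up≡v1 uq≡v1 → impV-≡ (trans up≡v1 (sym uq≡v1))

char-above : Classical w → u ≤I w → CharModel u w
char-above {w = w} {u = u} cw u≤w =
  (λ p → lift) , λ p q up≡v1 uq≡v1 → impV-≡ (trans (lift up≡v1) (sym (lift uq≡v1)))
  where
  lift : ∀ {p x} → u p ≡ x → w p ≡ there x
  lift {p} e = trans (≤I-classical⇒there cw u≤w p) (cong there e)

there-≡-cases : ∀ x y → there x ≡ there y → (y ≡ v2 → x ≡ v2) →
  x ≡ there x ⊎ (x ≡ v1 × y ≡ v1)
there-≡-cases v0 y  _  _ = inj₁ refl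
there-≡-cases v2 y  _  _ = inj₁ refl
there-≡-cases v1 v1 _  _ = inj₂ (refl , refl)
there-≡-cases v1 v0 () _
there-≡-cases v1 v2 _  h with h refl
... | ()

there-≡-linked : ∀ x y → there x ≡ there y → (y ≡ v2 → x ≡ v2) →
  (y ≡ v1 → impV v1 x ≡ v2) → (y ≡ v1 → impV x v1 ≡ v2) → x ≡ y
there-≡-linked x  v2 _  h _ _ = h refl
there-≡-linked v0 v0 _  _ _ _ = refl
there-≡-linked v1 v1 _  _ _ _ = refl
there-≡-linked v1 v0 () _ _ _
there-≡-linked v2 v0 () _ _ _
there-≡-linked v0 v1 _  _ k _ with k refl
... | ()
there-≡-linked v2 v1 _  _ _ k with k refl
... | ()

≤I-classical⇒same-there : Classical w → u′ ≤I w → u ≤I w → ∀ p → there (u′ p) ≡ there (u p)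
≤I-classical⇒same-there cw u′≤w u≤w p =
  trans (sym (≤I-classical⇒there cw u′≤w p)) (≤I-classical⇒there cw u≤w p)

-- If u′ keeps some atom p with u p = 1 at the value 1, the links p → q and
-- q → p force u′ q = 1 for every q with u q = 1; on all other atoms u and u′
-- both agree with w.
char-below : Classical w → u ≤I w → u′ ≤I w → CharModel u u′ →
  ∀ p → u′ p ≡ w p ⊎ u′ ≗I u
char-below {w = w} {u = u} {u′ = u′} cw u≤w u′≤w (atoms , links) p
  with there-≡-cases (u′ p) (u p) (≤I-classical⇒same-there cw u′≤w u≤w p) (atoms p)
... | inj₁ u′p≡there = inj₁ (trans u′p≡there (sym (≤I-classical⇒there cw u′≤w p)))
... | inj₂ (u′p≡v1 , up≡v1) = inj₂ λ q →
  there-≡-linked (u′ q) (u q) (≤I-classical⇒same-there cw u′≤w u≤w q) (atoms q)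
    (λ uq≡v1 → subst (λ z → impV z (u′ q) ≡ v2) u′p≡v1 (links p q up≡v1 uq≡v1))
    (λ uq≡v1 → subst (λ z → impV (u′ q) z ≡ v2) u′p≡v1 (links q p uq≡v1 up≡v1))

equilibrium-∧char : ∀ α → Classical w → u ≤I w → Model w α → (Model u α → u ≗I w) →
  Equilibrium (α ∧f char u) w
equilibrium-∧char {w = w} {u = u} α cw u≤w mα u-model⇒≗w =
  cw , from (model-∧ α (char u)) (mα , from (model-char u) (char-above cw u≤w)) , minimal
  where
  minimal : ∀ u′ → u′ ≤I w → Model u′ (α ∧f char u) → u′ ≗I w
  minimal u′ u′≤w m p =
    let mα′ , mchar = to (model-∧ α (char u)) m in
    [ id , (λ u′≗u → trans (u′≗u p) (u-model⇒≗w (model-cong α u′≗u mα′) p)) ]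
      (char-below cw u≤w u′≤w (to (model-char u) mchar) p)

strongly-entails⇒classical : StronglyEntails α β → cl ⟦ α ⟧ ⊆ cl ⟦ β ⟧
strongly-entails⇒classical {α = α} {β = β} se v (hα , cv) =
  model⇒⟦⟧ β v (proj₁ (to (model-∧ β (char v)) (proj₁ (proj₂ (se (char v) v equilibrium))))) , cv
  where
  equilibrium : Equilibrium (α ∧f char v) v
  equilibrium = equilibrium-∧char α cv ≤I-refl (⟦⟧⇒model α v hα) (λ _ _ → refl)

strongly-entails⇒downward : StronglyEntails α β → (down (cl ⟦ α ⟧) ∩ ⟦ β ⟧) ⊆ ⟦ α ⟧
strongly-entails⇒downward {α = α} {β = β} se u ((w , (hα , cw) , u≤w) , hβ) =
  model⇒⟦⟧ α u (decidable-stable (model? u α) λ ¬mα → ¬mα (refuted ¬mα))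
  where
  refuted : ¬ Model u α → Model u α
  refuted ¬mα = model-cong α (λ p → sym (u≗w p)) (⟦⟧⇒model α w hα)
    where
    equilibrium : Equilibrium (α ∧f char u) w
    equilibrium = equilibrium-∧char α cw u≤w (⟦⟧⇒model α w hα) (⊥-elim ∘ ¬mα)
    u≗w : u ≗I w
    u≗w = proj₂ (proj₂ (se (char u) w equilibrium)) u u≤w
      (from (model-∧ β (char u)) (⟦⟧⇒model β u hβ , from (model-char u) char-self))

conditions⇒strongly-entails : cl ⟦ α ⟧ ⊆ cl ⟦ β ⟧ → (down (cl ⟦ α ⟧) ∩ ⟦ β ⟧) ⊆ ⟦ α ⟧ →
  StronglyEntails α β
conditions⇒strongly-entails {α = α} {β = β} classical downward γ v (cv , m , minimal) =
  cv , from (model-∧ β γ) (⟦⟧⇒model β v (proj₁ (classical v hα)) , mγ) , minimal′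
  where
  mα : Model v α
  mα = proj₁ (to (model-∧ α γ) m)
  mγ : Model v γ
  mγ = proj₂ (to (model-∧ α γ) m)
  hα : cl ⟦ α ⟧ v
  hα = model⇒⟦⟧ α v mα , cv
  minimal′ : ∀ u → u ≤I v → Model u (β ∧f γ) → u ≗I v
  minimal′ u u≤v mu =
    let mβ , mγu = to (model-∧ β γ) mu in
    minimal u u≤v (from (model-∧ α γ)
      (⟦⟧⇒model α u (downward u ((v , hα , u≤v) , model⇒⟦⟧ β u mβ)) , mγu))

theorem9 : ∀ {n : ℕ} (α β : Form n) →
    StronglyEntails α β ⇔
    ((cl ⟦ α ⟧ ⊆ cl ⟦ β ⟧) × ((down (cl ⟦ α ⟧) ∩ ⟦ β ⟧) ⊆ ⟦ α ⟧))
theorem9 α β = mk⇔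
  (λ se → strongly-entails⇒classical {α = α} {β = β} se , strongly-entails⇒downward {α = α} {β = β} se)
  (λ (classical , downward) → conditions⇒strongly-entails {α = α} {β = β} classical downward)
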